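{- For every $n\ge 1$ and all bi-persistent formulas $\phi,\psi_1,\dots,\psi_n$, $$\vdash_{\mathbf{MP}^*}\Diamond\mathsf{K}\phi\land\bigwedge_{i=1}^n\mathsf{L}(\Diamond\mathsf{K}\phi\land\psi_i)\to\Diamond\Big(\mathsf{K}\phi\land\bigwedge_{i=1}^n\mathsf{L}\psi_i\Big).$$
   Context: Formulas: built from a countable set $\mathsf{A}$ of atomic formulas (containing $\top,\bot$) by $\land,\neg,\Box,\mathsf{K}$; $\Diamond\phi:=\neg\Box\neg\phi$, $\mathsf{L}\phi:=\neg\mathsf{K}\neg\phi$. A formula $\phi$ is bi-persistent if $(\phi\to\Box\phi)\land(\neg\phi\to\Box\neg\phi)$ is a theorem of $\mathbf{MP}^*$. The system $\mathbf{MP}^*$ has rules modus ponens, $\mathsf{K}$-necessitation, $\Box$-necessitation and axioms all instances of: (1) propositional tautologies; (2) $(A\to\Box A)\land(\neg A\to\Box\neg A)$ for atomic $A$; (3) $\Box(\phi\to\psi)\to(\Box\phi\to\Box\psi)$; (4) $\Box\phi\to\phi$; (5) $\Box\phi\to\Box\Box\phi$; (6) $\mathsf{K}(\phi\to\psi)\to(\mathsf{K}\phi\to\mathsf{K}\psi)$; (7) $\mathsf{K}\phi\to\phi$; (8) $\mathsf{K}\phi\to\mathsf{K}\mathsf{K}\phi$; (9) $\phi\to\mathsf{K}\mathsf{L}\phi$; (10) $\mathsf{K}\Box\phi\to\Box\mathsf{K}\phi$; (11) $\Diamond\Box\phi\to\Box\Diamond\phi$; (12) $\Diamond(\mathsf{K}\phi\land\psi)\land\mathsf{L}\Diamond(\mathsf{K}\phi\land\chi)\to\Diamond(\mathsf{K}\Diamond\phi\land\Diamond\psi\land\mathsf{L}\Diamond\chi)$.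 -}

module Defs where

open import Data.Nat using (ℕ; zero; suc)
open import Data.Fin using (Fin; zero; suc)
open import Data.Bool using (Bool; true; false; _∧_; not)
open import Relation.Binary.PropositionalEquality using (_≡_)

data Atom : Set where
  top : Atom
  bot : Atom
  var : ℕ → Atom

data Formula : Set where
  atom : Atom → Formula
  _∧'_ : Formula → Formula → Formula
  ¬'_  : Formula → Formula
  □_   : Formula → Formula
  K_   : Formula → Formula

infixr 6 _∧'_
infix 7 ¬'_ □_ K_
infixr 5 _⇒_

⊤' : Formula
⊤' = atom top

⊥' : Formula
⊥' = atom bot

_⇒_ : Formula → Formula → Formula
φ ⇒ ψ = ¬' (φ ∧' ¬' ψ)

◇_ : Formula → Formula
◇ φ = ¬' □ ¬' φ

L_ : Formula → Formula
L φ = ¬' K ¬' φ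

infix 7 ◇_ L_

-- Propositional tautologies: boolean valuations assign values to the
-- propositionally atomic subformulas (atoms, □-formulas, K-formulas),
-- with ⊤ true and ⊥ false.
record Valuation : Set where
  field
    vAtom : ℕ → Bool
    vBox  : Formula → Bool
    vK    : Formula → Bool

eval : Valuation → Formula → Bool
eval v (atom top) = true
eval v (atom bot) = false
eval v (atom (var n)) = Valuation.vAtom v n
eval v (φ ∧' ψ) = eval v φ ∧ eval v ψ
eval v (¬' φ) = not (eval v φ)
eval v (□ φ) = Valuation.vBox v φ
eval v (K φ) = Valuation.vK v φ

Tautology : Formula → Set
Tautology φ = (v : Valuation) → eval v φ ≡ true

data ⊢_ : Formula → Set where
  mp     : ∀ {φ ψ} → ⊢ (φ ⇒ ψ) → ⊢ φ → ⊢ ψ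
  K-nec  : ∀ {φ} → ⊢ φ → ⊢ K φ
  □-nec  : ∀ {φ} → ⊢ φ → ⊢ □ φ
  ax1  : ∀ {φ} → Tautology φ → ⊢ φ
  ax2  : ∀ (a : Atom) → ⊢ ((atom a ⇒ □ atom a) ∧' (¬' atom a ⇒ □ ¬' atom a))
  ax3  : ∀ φ ψ → ⊢ (□ (φ ⇒ ψ) ⇒ (□ φ ⇒ □ ψ))
  ax4  : ∀ φ → ⊢ (□ φ ⇒ φ)
  ax5  : ∀ φ → ⊢ (□ φ ⇒ □ □ φ)
  ax6  : ∀ φ ψ → ⊢ (K (φ ⇒ ψ) ⇒ (K φ ⇒ K ψ))
  ax7  : ∀ φ → ⊢ (K φ ⇒ φ)
  ax8  : ∀ φ → ⊢ (K φ ⇒ K K φ)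
  ax9  : ∀ φ → ⊢ (φ ⇒ K L φ)
  ax10 : ∀ φ → ⊢ (K □ φ ⇒ □ K φ)
  ax11 : ∀ φ → ⊢ (◇ □ φ ⇒ □ ◇ φ)
  ax12 : ∀ φ ψ χ →
    ⊢ ((◇ (K φ ∧' ψ) ∧' L ◇ (K φ ∧' χ)) ⇒ ◇ (K ◇ φ ∧' ◇ ψ ∧' L ◇ χ))

infix 3 ⊢_

BiPersistent : Formula → Set
BiPersistent φ = ⊢ ((φ ⇒ □ φ) ∧' (¬' φ ⇒ □ ¬' φ))

-- Conjunction of a nonempty family ψ 0, …, ψ m (i.e. n = m+1 conjuncts),
-- bracketed to the right: ψ 0 ∧ (ψ 1 ∧ (… ∧ ψ m)).
⋀ : (m : ℕ) → (Fin (suc m) → Formula) → Formula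
⋀ zero ψ = ψ zero
⋀ (suc m) ψ = ψ zero ∧' ⋀ m (λ i → ψ (suc i))

{-# OPTIONS --safe #-}
-- Axiom 12 adds one conjunct L ψ at a time under the diamond: from ◇(K φ ∧ P) and
-- L ◇(K φ ∧ ψ) it yields ◇(K ◇φ ∧ ◇P ∧ L ◇ψ).  Bi-persistent formulas satisfy ◇φ → φ,
-- which strips the inner diamonds from K ◇φ and L ◇ψ; the conjunction P of the L ψⱼ
-- collected so far satisfies ◇P → P as well, because by axiom 10 K of a persistent
-- formula is persistent.  Persistence of ψ turns the hypothesis L(◇K φ ∧ ψ) into
-- L ◇(K φ ∧ ψ).  The first conjunct is added to P = ⊤.
module Submission where

open import Defs
open import Data.Nat using (ℕ; zero; suc)
open import Data.Fin using (Fin; zero; suc)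
open import Data.Bool using (Bool; true; false; _∧_; not; T)
open import Data.Bool.Properties using (T-∧; T-≡)
open import Data.Product using (proj₁; proj₂)
open import Data.Unit using (tt)  -- the instance that discharges Valid p
open import Data.Vec using (Vec; []; _∷_; lookup; map)
open import Data.Vec.Properties using (lookup-map)
open import Function using (_∘_; Equivalence)
open import Relation.Binary.PropositionalEquality using (_≡_; refl; sym; trans; cong; cong₂)
import Relation.Binary.Reasoning.Base.Single as SingleReasoning

open Equivalence using (to)

data Skeleton (n : ℕ) : Set where
  letter : Fin n → Skeleton n
  ⊤ˢ     : Skeleton n
  _&_    : Skeleton n → Skeleton n → Skeleton n
  ~_     : Skeleton n → Skeleton n

infixr 6 _&_
infix 7 ~_
infixr 5 _⊃_

_⊃_ : ∀ {n} → Skeleton n → Skeleton n → Skeleton n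
p ⊃ q = ~ (p & ~ q)

instantiate : ∀ {n} → Vec Formula n → Skeleton n → Formula
instantiate σ (letter i) = lookup σ i
instantiate σ ⊤ˢ         = ⊤'
instantiate σ (p & q)    = instantiate σ p ∧' instantiate σ q
instantiate σ (~ p)      = ¬' instantiate σ p

truth : ∀ {n} → Vec Bool n → Skeleton n → Bool
truth ρ (letter i) = lookup ρ i
truth ρ ⊤ˢ         = true
truth ρ (p & q)    = truth ρ p ∧ truth ρ q
truth ρ (~ p)      = not (truth ρ p)

eval-instantiate : ∀ {n} (val : Valuation) (σ : Vec Formula n) (p : Skeleton n) →
  eval val (instantiate σ p) ≡ truth (map (eval val) σ) p
eval-instantiate val σ (letter i) = sym (lookup-map i (eval val) σ)
eval-instantiate val σ ⊤ˢ         = refl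
eval-instantiate val σ (p & q)    = cong₂ _∧_ (eval-instantiate val σ p) (eval-instantiate val σ q)
eval-instantiate val σ (~ p)      = cong not (eval-instantiate val σ p)

everyRow : (n : ℕ) → (Vec Bool n → Bool) → Bool
everyRow zero    f = f []
everyRow (suc n) f = everyRow n (f ∘ (true ∷_)) ∧ everyRow n (f ∘ (false ∷_))

everyRow-sound : ∀ n (f : Vec Bool n → Bool) → T (everyRow n f) → ∀ ρ → T (f ρ)
everyRow-sound zero    f h []          = h
everyRow-sound (suc n) f h (true ∷ ρ)  = everyRow-sound n _ (proj₁ (to T-∧ h)) ρ
everyRow-sound (suc n) f h (false ∷ ρ) = everyRow-sound n _ (proj₂ (to T-∧ h)) ρ

Valid : ∀ {n} → Skeleton n → Set
Valid {n} p = T (everyRow n (λ ρ → truth ρ p))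

tautology : ∀ {n} (p : Skeleton n) {{_ : Valid p}} (σ : Vec Formula n) → ⊢ instantiate σ p
tautology {n} p {{valid}} σ = ax1 λ val →
  trans (eval-instantiate val σ p) (to T-≡ (everyRow-sound n _ valid (map (eval val) σ)))

x₀ : ∀ {n} → Skeleton (suc n)
x₀ = letter zero

x₁ : ∀ {n} → Skeleton (suc (suc n))
x₁ = letter (suc zero)

x₂ : ∀ {n} → Skeleton (suc (suc (suc n)))
x₂ = letter (suc (suc zero))

x₃ : ∀ {n} → Skeleton (suc (suc (suc (suc n))))
x₃ = letter (suc (suc (suc zero)))

variable
  A B C A′ B′ φ χ P : Formula

⇒-refl : ⊢ A ⇒ A
⇒-refl {A} = tautology (x₀ ⊃ x₀) (A ∷ [])

⇒-trans : ⊢ A ⇒ B → ⊢ B ⇒ C → ⊢ A ⇒ C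
⇒-trans {A} {B} {C} = mp ∘ mp (tautology ((x₀ ⊃ x₁) ⊃ (x₁ ⊃ x₂) ⊃ (x₀ ⊃ x₂)) (A ∷ B ∷ C ∷ []))

module ⇒-Reasoning = SingleReasoning (λ A B → ⊢ A ⇒ B) ⇒-refl ⇒-trans
open ⇒-Reasoning

contraposition : ⊢ A ⇒ B → ⊢ ¬' B ⇒ ¬' A
contraposition {A} {B} = mp (tautology ((x₀ ⊃ x₁) ⊃ (~ x₁ ⊃ ~ x₀)) (A ∷ B ∷ []))

∧-map : ⊢ A ⇒ A′ → ⊢ B ⇒ B′ → ⊢ A ∧' B ⇒ A′ ∧' B′
∧-map {A} {A′} {B} {B′} =
  mp ∘ mp (tautology ((x₀ ⊃ x₁) ⊃ (x₂ ⊃ x₃) ⊃ (x₀ & x₂ ⊃ x₁ & x₃)) (A ∷ A′ ∷ B ∷ B′ ∷ []))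

⇒-∧ : ⊢ A ⇒ B → ⊢ A ⇒ C → ⊢ A ⇒ B ∧' C
⇒-∧ {A} {B} {C} = mp ∘ mp (tautology ((x₀ ⊃ x₁) ⊃ (x₀ ⊃ x₂) ⊃ (x₀ ⊃ x₁ & x₂)) (A ∷ B ∷ C ∷ []))

□-mono : ⊢ A ⇒ B → ⊢ □ A ⇒ □ B
□-mono {A} {B} = mp (ax3 A B) ∘ □-nec

◇-mono : ⊢ A ⇒ B → ⊢ ◇ A ⇒ ◇ B
◇-mono = contraposition ∘ □-mono ∘ contraposition

K-mono : ⊢ A ⇒ B → ⊢ K A ⇒ K B
K-mono {A} {B} = mp (ax6 A B) ∘ K-nec

L-mono : ⊢ A ⇒ B → ⊢ L A ⇒ L B
L-mono = contraposition ∘ K-mono ∘ contraposition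

◇-∧-□ : ⊢ ◇ A ∧' □ B ⇒ ◇ (A ∧' B)
◇-∧-□ {A} {B} =
  mp (tautology ((x₁ ⊃ x₂ ⊃ x₀) ⊃ (~ x₀ & x₁ ⊃ ~ x₂)) (□ ¬' A ∷ □ B ∷ □ ¬' (A ∧' B) ∷ []))
     (⇒-trans (□-mono (tautology (x₁ ⊃ ~ (x₀ & x₁) ⊃ ~ x₀) (A ∷ B ∷ []))) (ax3 (¬' (A ∧' B)) (¬' A)))

Persistent : Formula → Set
Persistent A = ⊢ A ⇒ □ A

K-persistent : Persistent A → Persistent (K A)
K-persistent {A} h = ⇒-trans (K-mono h) (ax10 A)

◇-∧-persistent : Persistent B → ⊢ ◇ A ∧' B ⇒ ◇ (A ∧' B)
◇-∧-persistent h = ⇒-trans (∧-map ⇒-refl h) ◇-∧-□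

persistent : BiPersistent φ → Persistent φ
persistent {φ} = mp (tautology ((x₀ ⊃ x₁) & (~ x₀ ⊃ x₂) ⊃ (x₀ ⊃ x₁)) (φ ∷ □ φ ∷ □ ¬' φ ∷ []))

¬-persistent : BiPersistent φ → Persistent (¬' φ)
¬-persistent {φ} = mp (tautology ((x₀ ⊃ x₁) & (~ x₀ ⊃ x₂) ⊃ (~ x₀ ⊃ x₂)) (φ ∷ □ φ ∷ □ ¬' φ ∷ []))

◇Closed : Formula → Set
◇Closed A = ⊢ ◇ A ⇒ A

◇Closed-if-¬-persistent : Persistent (¬' A) → ◇Closed A
◇Closed-if-¬-persistent {A} = mp (tautology ((~ x₀ ⊃ x₁) ⊃ (~ x₁ ⊃ x₀)) (A ∷ □ ¬' A ∷ []))

◇Closed-⊤ : ◇Closed ⊤'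
◇Closed-⊤ = tautology (x₀ ⊃ ⊤ˢ) (◇ ⊤' ∷ [])

◇Closed-∧ : ◇Closed A → ◇Closed B → ◇Closed (A ∧' B)
◇Closed-∧ {A} {B} hA hB = begin
  ◇ (A ∧' B)    ∼⟨ ⇒-∧ (◇-mono (tautology (x₀ & x₁ ⊃ x₀) (A ∷ B ∷ [])))
                       (◇-mono (tautology (x₀ & x₁ ⊃ x₁) (A ∷ B ∷ []))) ⟩
  ◇ A ∧' ◇ B    ∼⟨ ∧-map hA hB ⟩
  A ∧' B        ∎

◇Closed-bipersistent : BiPersistent φ → ◇Closed φ
◇Closed-bipersistent = ◇Closed-if-¬-persistent ∘ ¬-persistent

◇Closed-L : BiPersistent φ → ◇Closed (L φ)
◇Closed-L {φ} bp = ◇Closed-if-¬-persistent (begin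
  ¬' ¬' K ¬' φ   ∼⟨ tautology (~ ~ x₀ ⊃ x₀) (K ¬' φ ∷ []) ⟩
  K ¬' φ         ∼⟨ K-persistent (¬-persistent bp) ⟩
  □ K ¬' φ       ∼⟨ □-mono (tautology (x₀ ⊃ ~ ~ x₀) (K ¬' φ ∷ [])) ⟩
  □ ¬' ¬' K ¬' φ ∎)

◇Closed-⋀-L : ∀ m (ψ : Fin (suc m) → Formula) → (∀ i → BiPersistent (ψ i)) →
  ◇Closed (⋀ m (λ i → L ψ i))
◇Closed-⋀-L zero    ψ bp = ◇Closed-L (bp zero)
◇Closed-⋀-L (suc m) ψ bp = ◇Closed-∧ (◇Closed-L (bp zero)) (◇Closed-⋀-L m (ψ ∘ suc) (bp ∘ suc))

◇K-∧-push-L : BiPersistent φ → BiPersistent χ → ◇Closed P →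
  ⊢ ◇ (K φ ∧' P) ∧' L (◇ K φ ∧' χ) ⇒ ◇ (K φ ∧' L χ ∧' P)
◇K-∧-push-L {φ} {χ} {P} bpφ bpχ closedP = begin
  ◇ (K φ ∧' P) ∧' L (◇ K φ ∧' χ)
    ∼⟨ ∧-map ⇒-refl (L-mono (◇-∧-persistent (persistent bpχ))) ⟩
  ◇ (K φ ∧' P) ∧' L ◇ (K φ ∧' χ)
    ∼⟨ ax12 φ P χ ⟩
  ◇ (K ◇ φ ∧' ◇ P ∧' L ◇ χ)
    ∼⟨ ◇-mono (∧-map (K-mono (◇Closed-bipersistent bpφ))
                     (∧-map closedP (L-mono (◇Closed-bipersistent bpχ)))) ⟩
  ◇ (K φ ∧' P ∧' L χ)
    ∼⟨ ◇-mono (tautology (x₀ & x₁ & x₂ ⊃ x₀ & x₂ & x₁) (K φ ∷ P ∷ L χ ∷ [])) ⟩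
  ◇ (K φ ∧' L χ ∧' P)
    ∎

mainTheorem12 : (n : ℕ) → (φ : Formula) → (ψ : Fin (suc n) → Formula) →
    BiPersistent φ → ((i : Fin (suc n)) → BiPersistent (ψ i)) →
    ⊢ ((◇ K φ ∧' ⋀ n (λ i → L (◇ K φ ∧' ψ i))) ⇒ ◇ (K φ ∧' ⋀ n (λ i → L ψ i)))
mainTheorem12 zero φ ψ bpφ bp = begin
  ◇ K φ ∧' L (◇ K φ ∧' ψ zero)
    ∼⟨ ∧-map (◇-mono (tautology (x₀ ⊃ x₀ & ⊤ˢ) (K φ ∷ []))) ⇒-refl ⟩
  ◇ (K φ ∧' ⊤') ∧' L (◇ K φ ∧' ψ zero)
    ∼⟨ ◇K-∧-push-L bpφ (bp zero) ◇Closed-⊤ ⟩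
  ◇ (K φ ∧' L ψ zero ∧' ⊤')
    ∼⟨ ◇-mono (tautology (x₀ & x₁ & ⊤ˢ ⊃ x₀ & x₁) (K φ ∷ L ψ zero ∷ [])) ⟩
  ◇ (K φ ∧' L ψ zero)
    ∎
mainTheorem12 (suc m) φ ψ bpφ bp = begin
  ◇ K φ ∧' L (◇ K φ ∧' ψ zero) ∧' ⋀ m (λ i → L (◇ K φ ∧' ψ (suc i)))
    ∼⟨ tautology (x₀ & x₁ & x₂ ⊃ (x₀ & x₂) & x₁) (◇ K φ ∷ L (◇ K φ ∧' ψ zero) ∷ _ ∷ []) ⟩
  (◇ K φ ∧' ⋀ m (λ i → L (◇ K φ ∧' ψ (suc i)))) ∧' L (◇ K φ ∧' ψ zero)
    ∼⟨ ∧-map (mainTheorem12 m φ (ψ ∘ suc) bpφ (bp ∘ suc)) ⇒-refl ⟩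
  ◇ (K φ ∧' ⋀ m (λ i → L ψ (suc i))) ∧' L (◇ K φ ∧' ψ zero)
    ∼⟨ ◇K-∧-push-L bpφ (bp zero) (◇Closed-⋀-L m (ψ ∘ suc) (bp ∘ suc)) ⟩
  ◇ (K φ ∧' L ψ zero ∧' ⋀ m (λ i → L ψ (suc i)))
    ∎
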